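{- Let $3 \le k < s$ be integers such that $(k,s)$ is an admissible pair. Then for every $n$, $c_{k-1}(n, C^k_s) \ge \lfloor n/2 \rfloor - k + 1$. Moreover, if $k$ is even, then $\mathrm{ex}_{k-1}(n, C^k_s) \ge \lfloor n/2\rfloor - k + 1$.
   Context: For integers $2 \le k < s$ with $d = \gcd(k,s)$, the pair $(k,s)$ is admissible if $d = 1$ or $k/d$ is even. A $k$-graph is a $k$-uniform hypergraph; $\delta_{k-1}(H)$ is the minimum over all $(k-1)$-sets of vertices of the number of edges containing that set. The tight cycle $C^k_s$ is the $k$-graph on $s$ vertices with a cyclic ordering of its vertices in which every $k$ consecutive vertices form an edge (these being its edges). A $k$-graph $H$ has an $F$-covering if every vertex lies in a copy of $F$ in $H$; $c_{k-1}(n,F)$ is the maximum of $\delta_{k-1}(H)$ over all $k$-graphs $H$ on $n$ vertices without an $F$-covering; $\mathrm{ex}_{k-1}(n,F)$ is the maximum of $\delta_{k-1}(H)$ over all $k$-graphs $H$ on $n$ vertices containing no copy of $F$. -}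

module Defs where

open import Data.Nat using (ℕ; zero; suc; _+_; _*_; _∸_; _≤_; _/_)
open import Data.Nat.DivMod using (_mod_)
open import Data.Nat.GCD using (gcd)
open import Data.Nat.Divisibility using (_∣_)
open import Data.Fin using (Fin; toℕ)
open import Data.Fin.Subset using (Subset; ⁅_⁆; _∪_; ⋃; ∣_∣; _∈_)
open import Data.Bool using (Bool; true; false; not; _∧_)
open import Data.Vec using (lookup; tabulate)
open import Data.List using (List; map; upTo)
open import Data.Product using (Σ; ∃; ∃-syntax; _×_)
open import Data.Sum using (_⊎_)
open import Function.Definitions using (Injective)
open import Relation.Binary.PropositionalEquality using (_≡_)

Admissible : ℕ → ℕ → Set
Admissible k s = gcd k s ≡ 1 ⊎ (∃[ q ] (k ≡ q * gcd k s × 2 ∣ q))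

record KGraph (k n : ℕ) : Set where
  field
    edge    : Subset n → Bool
    uniform : ∀ e → edge e ≡ true → ∣ e ∣ ≡ k
open KGraph public

codeg : ∀ {k n} → KGraph k n → Subset n → ℕ
codeg H S = ∣ tabulate (λ v → not (lookup S v) ∧ edge H (S ∪ ⁅ v ⁆)) ∣

MinCodegAtLeast : ∀ {k n} → KGraph k n → ℕ → Set
MinCodegAtLeast {k} {n} H m = ∀ (S : Subset n) → ∣ S ∣ ≡ k ∸ 1 → m ≤ codeg H S

window : ∀ {s n} → (k : ℕ) → (Fin s → Fin n) → Fin s → Subset n
window {suc s'} k φ i = ⋃ (map (λ j → ⁅ φ ((toℕ i + j) mod suc s') ⁆) (upTo k))

IsTightCycleCopy : ∀ {k n} → (s : ℕ) → KGraph k n → (Fin s → Fin n) → Set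
IsTightCycleCopy {k} s H φ = Injective _≡_ _≡_ φ × (∀ i → edge H (window k φ i) ≡ true)

ContainsTightCycle : ∀ {k n} → (s : ℕ) → KGraph k n → Set
ContainsTightCycle {n = n} s H = ∃[ φ ] IsTightCycleCopy s H φ

HasTightCycleCovering : ∀ {k n} → (s : ℕ) → KGraph k n → Set
HasTightCycleCovering {n = n} s H =
  ∀ (v : Fin n) → ∃[ φ ] (IsTightCycleCopy s H φ × ∃[ i ] (φ i ≡ v))

-- Let A be every other vertex and let H consist of the k-sets meeting A in
-- an odd number of vertices. A (k-1)-set S extends to an edge exactly by the
-- vertices of A (if |S ∩ A| is even) or of its complement (if odd) outside S,
-- so its codegree is at least ⌊n/2⌋ - (k-1). Along a copy of C^k_s in H, the
-- indicator α of A is an s-periodic sequence all of whose k-windows have odd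
-- sum; comparing the windows at m and m+1 shows that α is k-periodic, hence
-- d-periodic for d = gcd(k,s), and the sum of a k-window is (k/d) times the
-- sum of a d-window. Thus k/d is odd, which is impossible when k/d is even;
-- when d = 1 it is constant, hence constantly 1, so the copy lies inside A. For an
-- admissible pair this rules out copies through vertices outside A, and for
-- even k it rules out copies altogether.
module Submission where

open import Defs
open import Data.Bool.Base using (Bool; true; false; not; _∧_; _xor_)
open import Data.Bool.Properties using (∧-conicalˡ; ∧-conicalʳ; T-≡; not-distribʳ-xor)
open import Data.Empty using (⊥-elim)
open import Data.Fin.Base using (Fin; zero; suc; toℕ)
open import Data.Fin.Properties using (toℕ-fromℕ<; fromℕ<-cong; fromℕ<-toℕ; toℕ<n)
open import Data.Fin.Subset
  using (Subset; inside; outside; ⁅_⁆; _∪_; _∩_; ∁; ⋃; ∣_∣; ⊤; _∈_; _∉_)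
open import Data.Fin.Subset.Properties
  using (∉⊥; ∈⊤; x∈⁅y⁆⇒x≡y; x∈p∪q⁻; _∈?_; ∪-comm; ∪-identityʳ; ∩-identityʳ; ∩-zeroˡ; ∣⊥∣≡0)
open import Data.List.Base using (applyUpTo)
open import Data.List.Properties using (map-applyUpTo)
open import Data.Nat.Base
  using (ℕ; zero; suc; _+_; _*_; _∸_; _≤_; _<_; _/_; _≡ᵇ_; z≤n; s≤s; z<s; s<s; NonZero; parity)
open import Data.Nat.Properties
open import Data.Nat.DivMod
  using (_%_; _mod_; m%n<n; m≡m%n+[m/n]*n; m%n%n≡m%n; %-distribˡ-+; [m+n]%n≡m%n; m<n⇒m%n≡m; m/n≡1+[m∸n]/n)
open import Data.Nat.Divisibility using (_∣_; divides; n∣m⇒m%n≡0)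
open import Data.Nat.GCD using (gcd; gcd-GCD; module Bézout)
open import Data.Parity.Base as ℙ using (Parity; 0ℙ; 1ℙ)
import Data.Parity.Properties as ℙ
open import Data.Product.Base using (_×_; _,_; proj₁; proj₂; ∃-syntax)
open import Data.Sum.Base using (inj₁; inj₂)
open import Data.Vec.Base using ([]; _∷_; lookup; map; tabulate; here; there)
open import Data.Vec.Properties using ([]=⇒lookup; lookup-map; tabulate-cong)
open import Function.Base using (_∘_; id)
open import Function.Bundles using (Equivalence)
open import Relation.Binary.PropositionalEquality
open import Relation.Nullary using (¬_; yes; no)

open ≡-Reasoning

bit : Bool → ℕ
bit false = 0
bit true  = 1

isOdd : Parity → Bool
isOdd 0ℙ = false
isOdd 1ℙ = true

isOdd≡true⇒≡1ℙ : ∀ {p} → isOdd p ≡ true → p ≡ 1ℙ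
isOdd≡true⇒≡1ℙ {1ℙ} _ = refl

isOdd[parity[bit]+p] : ∀ b p → isOdd (parity (bit b) ℙ.+ p) ≡ isOdd p xor b
isOdd[parity[bit]+p] false 0ℙ = refl
isOdd[parity[bit]+p] false 1ℙ = refl
isOdd[parity[bit]+p] true  0ℙ = refl
isOdd[parity[bit]+p] true  1ℙ = refl

parity∘bit-injective : ∀ {a b} → parity (bit a) ≡ parity (bit b) → a ≡ b
parity∘bit-injective {false} {false} _ = refl
parity∘bit-injective {true}  {true}  _ = refl

p*q≡1ℙ⇒p≡1ℙ×q≡1ℙ : ∀ {p q} → p ℙ.* q ≡ 1ℙ → p ≡ 1ℙ × q ≡ 1ℙ
p*q≡1ℙ⇒p≡1ℙ×q≡1ℙ {1ℙ} {1ℙ} _ = refl , refl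

2∣n⇒parity≡0ℙ : ∀ {n} → 2 ∣ n → parity n ≡ 0ℙ
2∣n⇒parity≡0ℙ (divides r refl) = trans (ℙ.*-homo-* r 2) (ℙ.*-zeroʳ (parity r))

count : (ℕ → Bool) → ℕ → ℕ
count f zero    = 0
count f (suc k) = bit (f 0) + count (f ∘ suc) k

count-cong : ∀ {f g} k → (∀ j → f j ≡ g j) → count f k ≡ count g k
count-cong zero    f≗g = refl
count-cong (suc k) f≗g = cong₂ _+_ (cong bit (f≗g 0)) (count-cong k (f≗g ∘ suc))

count-+ : ∀ f a b → count f (a + b) ≡ count f a + count (f ∘ (a +_)) b
count-+ f zero    b = refl
count-+ f (suc a) b =
  trans (cong (bit (f 0) +_) (count-+ (f ∘ suc) a b)) (sym (+-assoc (bit (f 0)) _ _))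

count-suc : ∀ f k → count f (suc k) ≡ count f k + bit (f k)
count-suc f zero    = +-comm (bit (f 0)) 0
count-suc f (suc k) =
  trans (cong (bit (f 0) +_) (count-suc (f ∘ suc) k)) (sym (+-assoc (bit (f 0)) _ _))

-- Periodic sequences

Periodic : {A : Set} → (ℕ → A) → ℕ → Set
Periodic α p = ∀ m → α (m + p) ≡ α m

module _ {A : Set} {α : ℕ → A} where

  periodic-* : ∀ {p} → Periodic α p → ∀ q → Periodic α (q * p)
  periodic-*         per zero    m = cong α (+-identityʳ m)
  periodic-* {p = p} per (suc q) m = begin
    α (m + (p + q * p)) ≡⟨ cong α (sym (+-assoc m p (q * p))) ⟩
    α (m + p + q * p)   ≡⟨ periodic-* per q (m + p) ⟩
    α (m + p)           ≡⟨ per m ⟩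
    α m                 ∎

  periodic-difference : ∀ {d p} → Periodic α p → Periodic α (d + p) → Periodic α d
  periodic-difference {d} {p} per-p per-d+p m = begin
    α (m + d)       ≡⟨ sym (per-p (m + d)) ⟩
    α (m + d + p)   ≡⟨ cong α (+-assoc m d p) ⟩
    α (m + (d + p)) ≡⟨ per-d+p m ⟩
    α m             ∎

  periodic-gcd : ∀ {a b} → Periodic α a → Periodic α b → Periodic α (gcd a b)
  periodic-gcd {a} {b} per-a per-b with Bézout.identity (gcd-GCD a b)
  ... | Bézout.+- x y eq = periodic-difference (periodic-* per-b y)
                             (subst (Periodic α) (sym eq) (periodic-* per-a x))
  ... | Bézout.-+ x y eq = periodic-difference (periodic-* per-a x)
                             (subst (Periodic α) (sym eq) (periodic-* per-b y))

  periodic-1⇒constant : Periodic α 1 → ∀ m → α m ≡ α 0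
  periodic-1⇒constant per zero    = refl
  periodic-1⇒constant per (suc m) =
    trans (cong α (+-comm 1 m)) (trans (per m) (periodic-1⇒constant per m))

count-periodic : ∀ {f d} → Periodic f d → ∀ q → count f (q * d) ≡ q * count f d
count-periodic         per zero    = refl
count-periodic {f} {d} per (suc q) = begin
  count f (d + q * d)                      ≡⟨ count-+ f d (q * d) ⟩
  count f d + count (f ∘ (d +_)) (q * d)   ≡⟨ cong (count f d +_) (count-cong (q * d) shift) ⟩
  count f d + count f (q * d)              ≡⟨ cong (count f d +_) (count-periodic per q) ⟩
  count f d + q * count f d                ∎
  where
  shift : ∀ j → f (d + j) ≡ f j
  shift j = trans (cong f (+-comm d j)) (per j)

OddWindows : (ℕ → Bool) → ℕ → Set
OddWindows α k = ∀ m → parity (count (α ∘ (m +_)) k) ≡ 1ℙ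

module _ {α : ℕ → Bool} {k : ℕ} (odd : OddWindows α k) where

  -- The window at m, extended by one, is also the window at m + 1 extended on the left.
  oddWindows⇒periodic : Periodic α k
  oddWindows⇒periodic m = parity∘bit-injective (ℙ.+-cancelˡ-≡ 1ℙ _ _ (begin
    1ℙ ℙ.+ parity (bit (α (m + k)))
      ≡⟨ cong (ℙ._+ parity (bit (α (m + k)))) (sym (odd m)) ⟩
    parity (count (α ∘ (m +_)) k) ℙ.+ parity (bit (α (m + k)))
      ≡⟨ sym (ℙ.+-homo-+ (count (α ∘ (m +_)) k) _) ⟩
    parity (count (α ∘ (m +_)) k + bit (α (m + k)))
      ≡⟨ cong parity (sym (count-suc (α ∘ (m +_)) k)) ⟩
    parity (count (α ∘ (m +_)) (suc k))
      ≡⟨ cong parity (cong₂ _+_ (cong (bit ∘ α) (+-identityʳ m))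
                                (count-cong k (λ j → cong α (+-suc m j)))) ⟩
    parity (bit (α m) + count (α ∘ (suc m +_)) k)
      ≡⟨ ℙ.+-homo-+ (bit (α m)) _ ⟩
    parity (bit (α m)) ℙ.+ parity (count (α ∘ (suc m +_)) k)
      ≡⟨ cong (parity (bit (α m)) ℙ.+_) (odd (suc m)) ⟩
    parity (bit (α m)) ℙ.+ 1ℙ
      ≡⟨ ℙ.+-comm _ 1ℙ ⟩
    1ℙ ℙ.+ parity (bit (α m)) ∎))

  module _ {s : ℕ} (per : Periodic α s) where

    oddWindows-quotient : ∀ {q} → k ≡ q * gcd k s →
                          parity q ≡ 1ℙ × parity (count α (gcd k s)) ≡ 1ℙ
    oddWindows-quotient {q} k≡q*d = p*q≡1ℙ⇒p≡1ℙ×q≡1ℙ (begin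
      parity q ℙ.* parity (count α d) ≡⟨ sym (ℙ.*-homo-* q _) ⟩
      parity (q * count α d)          ≡⟨ cong parity (sym (count-periodic per-d q)) ⟩
      parity (count α (q * d))        ≡⟨ cong (parity ∘ count α) (sym k≡q*d) ⟩
      parity (count α k)              ≡⟨ odd 0 ⟩
      1ℙ                              ∎)
      where
      d = gcd k s
      per-d = periodic-gcd oddWindows⇒periodic per

    oddWindows-quotient-odd : ∀ {q} → k ≡ q * gcd k s → ¬ 2 ∣ q
    oddWindows-quotient-odd {q} k≡q*d 2∣q =
      ℙ.p≢p⁻¹ 0ℙ (trans (sym (2∣n⇒parity≡0ℙ 2∣q)) (proj₁ (oddWindows-quotient {q} k≡q*d)))

    oddWindows-coprime⇒true : gcd k s ≡ 1 → ∀ m → α m ≡ true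
    oddWindows-coprime⇒true d≡1 m = trans (periodic-1⇒constant per-1 m) α0≡true
      where
      per-1 : Periodic α 1
      per-1 = subst (Periodic α) d≡1 (periodic-gcd oddWindows⇒periodic per)
      k≡k*d : k ≡ k * gcd k s
      k≡k*d = trans (sym (*-identityʳ k)) (cong (k *_) (sym d≡1))
      α0≡true : α 0 ≡ true
      α0≡true = parity∘bit-injective (begin
        parity (bit (α 0))     ≡⟨ cong parity (sym (+-identityʳ (bit (α 0)))) ⟩
        parity (count α 1)     ≡⟨ subst (λ d → parity (count α d) ≡ 1ℙ) d≡1
                                    (proj₂ (oddWindows-quotient {k} k≡k*d)) ⟩
        1ℙ                     ∎)

admissible-even : ∀ {k s} → 2 ∣ k → Admissible k s → ∃[ q ] (k ≡ q * gcd k s × 2 ∣ q)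
admissible-even {k} 2∣k (inj₁ d≡1) =
  k , trans (sym (*-identityʳ k)) (cong (k *_) (sym d≡1)) , 2∣k
admissible-even _ (inj₂ witness) = witness

oddWindows-admissible⇒true : ∀ {α k s} → Admissible k s → Periodic α s → OddWindows α k →
                             ∀ m → α m ≡ true
oddWindows-admissible⇒true {k = k} (inj₁ d≡1) per odd =
  oddWindows-coprime⇒true {k = k} odd per d≡1
oddWindows-admissible⇒true {k = k} (inj₂ (q , k≡q*d , 2∣q)) per odd m =
  ⊥-elim (oddWindows-quotient-odd {k = k} odd per {q} k≡q*d 2∣q)

[m+n]%o≡m%o⇒o∣n : ∀ m n o .{{_ : NonZero o}} → (m + n) % o ≡ m % o → o ∣ n
[m+n]%o≡m%o⇒o∣n m n o eq = divides ((m + n) / o ∸ m / o) (begin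
  n                                             ≡⟨ sym (m+n∸m≡n m n) ⟩
  m + n ∸ m                                     ≡⟨ cong₂ _∸_ (m≡m%n+[m/n]*n (m + n) o) (m≡m%n+[m/n]*n m o) ⟩
  ((m + n) % o + (m + n) / o * o) ∸ (m % o + m / o * o)
                                                ≡⟨ cong (λ r → (r + (m + n) / o * o) ∸ (m % o + m / o * o)) eq ⟩
  (m % o + (m + n) / o * o) ∸ (m % o + m / o * o) ≡⟨ [m+n]∸[m+o]≡n∸o (m % o) _ _ ⟩
  (m + n) / o * o ∸ m / o * o                   ≡⟨ sym (*-distribʳ-∸ o ((m + n) / o) (m / o)) ⟩
  ((m + n) / o ∸ m / o) * o                     ∎)

[m+i]%n≡[m+j]%n⇒i≡j : ∀ m {i j n} .{{_ : NonZero n}} → i ≤ j → j < n →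
                       (m + i) % n ≡ (m + j) % n → i ≡ j
[m+i]%n≡[m+j]%n⇒i≡j m {i} {j} {n} i≤j j<n eq = begin
  i           ≡⟨ sym (+-identityʳ i) ⟩
  i + 0       ≡⟨ cong (i +_) (sym t≡0) ⟩
  i + (j ∸ i) ≡⟨ m+[n∸m]≡n i≤j ⟩
  j           ∎
  where
  n∣t : n ∣ j ∸ i
  n∣t = [m+n]%o≡m%o⇒o∣n (m + i) (j ∸ i) n
          (trans (cong (_% n) (trans (+-assoc m i _) (cong (m +_) (m+[n∸m]≡n i≤j)))) (sym eq))
  t≡0 : j ∸ i ≡ 0
  t≡0 = trans (sym (m<n⇒m%n≡m (≤-<-trans (m∸n≤m j i) j<n))) (n∣m⇒m%n≡0 (j ∸ i) n n∣t)

[m+n]%o≡[m%o+n]%o : ∀ m n o .{{_ : NonZero o}} → (m + n) % o ≡ (m % o + n) % o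
[m+n]%o≡[m%o+n]%o m n o = begin
  (m + n) % o             ≡⟨ %-distribˡ-+ m n o ⟩
  (m % o + n % o) % o     ≡⟨ cong (λ r → (r + n % o) % o) (sym (m%n%n≡m%n m o)) ⟩
  (m % o % o + n % o) % o ≡⟨ sym (%-distribˡ-+ (m % o) n o) ⟩
  (m % o + n) % o         ∎

∣p∣≤∣q∣+∣∁q∩p∣ : ∀ {n} (p q : Subset n) → ∣ p ∣ ≤ ∣ q ∣ + ∣ ∁ q ∩ p ∣
∣p∣≤∣q∣+∣∁q∩p∣ []            []            = z≤n
∣p∣≤∣q∣+∣∁q∩p∣ (inside  ∷ p) (inside  ∷ q) = s≤s (∣p∣≤∣q∣+∣∁q∩p∣ p q)
∣p∣≤∣q∣+∣∁q∩p∣ (outside ∷ p) (inside  ∷ q) = m≤n⇒m≤1+n (∣p∣≤∣q∣+∣∁q∩p∣ p q)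
∣p∣≤∣q∣+∣∁q∩p∣ (inside  ∷ p) (outside ∷ q) =
  ≤-trans (s≤s (∣p∣≤∣q∣+∣∁q∩p∣ p q)) (≤-reflexive (sym (+-suc _ _)))
∣p∣≤∣q∣+∣∁q∩p∣ (outside ∷ p) (outside ∷ q) = ∣p∣≤∣q∣+∣∁q∩p∣ p q

tabulate[¬p∧q]≡∁p∩q : ∀ {n} (p q : Subset n) → tabulate (λ x → not (lookup p x) ∧ lookup q x) ≡ ∁ p ∩ q
tabulate[¬p∧q]≡∁p∩q []      []      = refl
tabulate[¬p∧q]≡∁p∩q (x ∷ p) (y ∷ q) = cong (not x ∧ y ∷_) (tabulate[¬p∧q]≡∁p∩q p q)

∣[p∪⁅x⁆]∩q∣≡[x∈q]+∣p∩q∣ : ∀ {n} (q : Subset n) {p x} → x ∉ p →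
                          ∣ (p ∪ ⁅ x ⁆) ∩ q ∣ ≡ bit (lookup q x) + ∣ p ∩ q ∣
∣[p∪⁅x⁆]∩q∣≡[x∈q]+∣p∩q∣ (inside  ∷ q) {outside ∷ p} {zero} _ =
  cong (λ r → suc ∣ r ∩ q ∣) (∪-identityʳ p)
∣[p∪⁅x⁆]∩q∣≡[x∈q]+∣p∩q∣ (outside ∷ q) {outside ∷ p} {zero} _ =
  cong (λ r → ∣ r ∩ q ∣) (∪-identityʳ p)
∣[p∪⁅x⁆]∩q∣≡[x∈q]+∣p∩q∣ _ {inside ∷ p} {zero} x∉p = ⊥-elim (x∉p here)
∣[p∪⁅x⁆]∩q∣≡[x∈q]+∣p∩q∣ (inside  ∷ q) {inside  ∷ p} {suc x} x∉p =
  trans (cong suc (∣[p∪⁅x⁆]∩q∣≡[x∈q]+∣p∩q∣ q (x∉p ∘ there))) (sym (+-suc _ _))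
∣[p∪⁅x⁆]∩q∣≡[x∈q]+∣p∩q∣ (inside  ∷ q) {outside ∷ p} {suc x} x∉p =
  ∣[p∪⁅x⁆]∩q∣≡[x∈q]+∣p∩q∣ q (x∉p ∘ there)
∣[p∪⁅x⁆]∩q∣≡[x∈q]+∣p∩q∣ (outside ∷ q) {inside  ∷ p} {suc x} x∉p =
  ∣[p∪⁅x⁆]∩q∣≡[x∈q]+∣p∩q∣ q (x∉p ∘ there)
∣[p∪⁅x⁆]∩q∣≡[x∈q]+∣p∩q∣ (outside ∷ q) {outside ∷ p} {suc x} x∉p =
  ∣[p∪⁅x⁆]∩q∣≡[x∈q]+∣p∩q∣ q (x∉p ∘ there)

∣p∪⁅x⁆∣≡1+∣p∣ : ∀ {n} {p : Subset n} {x} → x ∉ p → ∣ p ∪ ⁅ x ⁆ ∣ ≡ suc ∣ p ∣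
∣p∪⁅x⁆∣≡1+∣p∣ {p = p} {x} x∉p = begin
  ∣ p ∪ ⁅ x ⁆ ∣               ≡⟨ cong ∣_∣ (sym (∩-identityʳ (p ∪ ⁅ x ⁆))) ⟩
  ∣ (p ∪ ⁅ x ⁆) ∩ ⊤ ∣         ≡⟨ ∣[p∪⁅x⁆]∩q∣≡[x∈q]+∣p∩q∣ ⊤ x∉p ⟩
  bit (lookup ⊤ x) + ∣ p ∩ ⊤ ∣ ≡⟨ cong₂ (λ b r → bit b + r) ([]=⇒lookup (∈⊤ {x = x})) (cong ∣_∣ (∩-identityʳ p)) ⟩
  suc ∣ p ∣                   ∎

∈⋃⁅ψ⁆⇒∃ : ∀ {n} (ψ : ℕ → Fin n) k {x} → x ∈ ⋃ (applyUpTo (⁅_⁆ ∘ ψ) k) → ∃[ j ] (j < k × ψ j ≡ x)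
∈⋃⁅ψ⁆⇒∃ ψ zero    x∈ = ⊥-elim (∉⊥ x∈)
∈⋃⁅ψ⁆⇒∃ ψ (suc k) x∈ with x∈p∪q⁻ ⁅ ψ 0 ⁆ _ x∈
... | inj₁ x∈⁅ψ0⁆ = 0 , z<s , sym (x∈⁅y⁆⇒x≡y (ψ 0) x∈⁅ψ0⁆)
... | inj₂ x∈rest with ∈⋃⁅ψ⁆⇒∃ (ψ ∘ suc) k x∈rest
...   | j , j<k , ψ[1+j]≡x = suc j , s<s j<k , ψ[1+j]≡x

∣⋃⁅ψ⁆∩q∣≡count : ∀ {n} (q : Subset n) (ψ : ℕ → Fin n) k →
                 (∀ {i j} → i < k → j < k → ψ i ≡ ψ j → i ≡ j) →
                 ∣ ⋃ (applyUpTo (⁅_⁆ ∘ ψ) k) ∩ q ∣ ≡ count (lookup q ∘ ψ) k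
∣⋃⁅ψ⁆∩q∣≡count {n} q ψ zero    _ = trans (cong ∣_∣ (∩-zeroˡ q)) (∣⊥∣≡0 n)
∣⋃⁅ψ⁆∩q∣≡count q ψ (suc k) ψ-injective with ψ 0 ∈? ⋃ (applyUpTo (⁅_⁆ ∘ ψ ∘ suc) k)
... | yes ψ0∈rest with ∈⋃⁅ψ⁆⇒∃ (ψ ∘ suc) k ψ0∈rest
...   | j , j<k , ψ[1+j]≡ψ0 with ψ-injective (s<s j<k) z<s ψ[1+j]≡ψ0
...     | ()
∣⋃⁅ψ⁆∩q∣≡count q ψ (suc k) ψ-injective | no ψ0∉rest = begin
  ∣ (⁅ ψ 0 ⁆ ∪ rest) ∩ q ∣             ≡⟨ cong (λ r → ∣ r ∩ q ∣) (∪-comm ⁅ ψ 0 ⁆ rest) ⟩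
  ∣ (rest ∪ ⁅ ψ 0 ⁆) ∩ q ∣             ≡⟨ ∣[p∪⁅x⁆]∩q∣≡[x∈q]+∣p∩q∣ q ψ0∉rest ⟩
  bit (lookup q (ψ 0)) + ∣ rest ∩ q ∣  ≡⟨ cong (bit (lookup q (ψ 0)) +_) (∣⋃⁅ψ⁆∩q∣≡count q (ψ ∘ suc) k
                                          (λ i<k j<k eq → suc-injective (ψ-injective (s<s i<k) (s<s j<k) eq))) ⟩
  count (lookup q ∘ ψ) (suc k)         ∎
  where rest = ⋃ (applyUpTo (⁅_⁆ ∘ ψ ∘ suc) k)

alternating : ∀ n → Bool → Subset n
alternating zero    b = []
alternating (suc n) b = b ∷ alternating n (not b)

map-xor-alternating : ∀ n b c → map (b xor_) (alternating n c) ≡ alternating n (b xor c)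
map-xor-alternating zero    b c = refl
map-xor-alternating (suc n) b c = cong ((b xor c) ∷_)
  (trans (map-xor-alternating n b (not c)) (cong (alternating n) (sym (not-distribʳ-xor b c))))

n/2≤∣alternating∣ : ∀ n b → n / 2 ≤ ∣ alternating n b ∣
n/2≤∣alternating∣ zero          b     = z≤n
n/2≤∣alternating∣ (suc zero)    b     = z≤n
n/2≤∣alternating∣ (suc (suc n)) true  =
  ≤-trans (≤-reflexive (m/n≡1+[m∸n]/n {suc (suc n)} {2} (s≤s (s≤s z≤n)))) (s≤s (n/2≤∣alternating∣ n true))
n/2≤∣alternating∣ (suc (suc n)) false =
  ≤-trans (≤-reflexive (m/n≡1+[m∸n]/n {suc (suc n)} {2} (s≤s (s≤s z≤n)))) (s≤s (n/2≤∣alternating∣ n false))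

-- The parity graph

parityGraph : ∀ k {n} → Subset n → KGraph k n
parityGraph k A = record
  { edge    = λ e → (∣ e ∣ ≡ᵇ k) ∧ isOdd (parity ∣ e ∩ A ∣)
  ; uniform = λ e e∈E → ≡ᵇ⇒≡ ∣ e ∣ k (Equivalence.from T-≡ (∧-conicalˡ _ _ e∈E))
  }

parityGraph-edge-insert : ∀ {k n} (A S : Subset n) {v} → v ∉ S → suc ∣ S ∣ ≡ k →
  edge (parityGraph k A) (S ∪ ⁅ v ⁆) ≡ isOdd (parity ∣ S ∩ A ∣) xor lookup A v
parityGraph-edge-insert {k} A S {v} v∉S 1+∣S∣≡k = begin
  (∣ S ∪ ⁅ v ⁆ ∣ ≡ᵇ k) ∧ isOdd (parity ∣ (S ∪ ⁅ v ⁆) ∩ A ∣)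
    ≡⟨ cong₂ _∧_ size-ok (cong (isOdd ∘ parity) (∣[p∪⁅x⁆]∩q∣≡[x∈q]+∣p∩q∣ A v∉S)) ⟩
  isOdd (parity (bit (lookup A v) + ∣ S ∩ A ∣))
    ≡⟨ cong isOdd (ℙ.+-homo-+ (bit (lookup A v)) ∣ S ∩ A ∣) ⟩
  isOdd (parity (bit (lookup A v)) ℙ.+ parity ∣ S ∩ A ∣)
    ≡⟨ isOdd[parity[bit]+p] (lookup A v) (parity ∣ S ∩ A ∣) ⟩
  isOdd (parity ∣ S ∩ A ∣) xor lookup A v ∎
  where
  size-ok : (∣ S ∪ ⁅ v ⁆ ∣ ≡ᵇ k) ≡ true
  size-ok = Equivalence.to T-≡ (≡⇒≡ᵇ _ _ (trans (∣p∪⁅x⁆∣≡1+∣p∣ v∉S) 1+∣S∣≡k))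

parityGraph-codeg : ∀ {k n} (A S : Subset n) → suc ∣ S ∣ ≡ k →
  codeg (parityGraph k A) S ≡ ∣ ∁ S ∩ map (isOdd (parity ∣ S ∩ A ∣) xor_) A ∣
parityGraph-codeg {k} A S 1+∣S∣≡k = begin
  codeg (parityGraph k A) S                          ≡⟨ cong ∣_∣ (tabulate-cong pointwise) ⟩
  ∣ tabulate (λ v → not (lookup S v) ∧ lookup L v) ∣ ≡⟨ cong ∣_∣ (tabulate[¬p∧q]≡∁p∩q S L) ⟩
  ∣ ∁ S ∩ L ∣                                        ∎
  where
  L = map (isOdd (parity ∣ S ∩ A ∣) xor_) A
  pointwise : ∀ v → not (lookup S v) ∧ edge (parityGraph k A) (S ∪ ⁅ v ⁆) ≡ not (lookup S v) ∧ lookup L v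
  pointwise v with v ∈? S
  ... | yes v∈S rewrite []=⇒lookup v∈S = refl
  ... | no  v∉S = cong (not (lookup S v) ∧_)
                    (trans (parityGraph-edge-insert A S v∉S 1+∣S∣≡k) (sym (lookup-map v _ A)))

alternating-minCodeg : ∀ {k} n → 1 ≤ k →
  MinCodegAtLeast (parityGraph k (alternating n false)) ((n / 2 + 1) ∸ k)
alternating-minCodeg {suc k} n _ S ∣S∣≡k =
  subst₂ _≤_ (cong (_∸ suc k) (+-comm 1 (n / 2))) (sym (parityGraph-codeg A S (cong suc ∣S∣≡k)))
    (≤-trans (∸-mono n/2≤∣L∣ (≤-reflexive ∣S∣≡k)) (m≤n+o⇒m∸n≤o ∣ L ∣ ∣ S ∣ (∣p∣≤∣q∣+∣∁q∩p∣ L S)))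
  where
  A = alternating n false
  b = isOdd (parity ∣ S ∩ A ∣)
  L = map (b xor_) A
  n/2≤∣L∣ : n / 2 ≤ ∣ L ∣
  n/2≤∣L∣ = subst (λ L → n / 2 ≤ ∣ L ∣) (sym (map-xor-alternating n b false)) (n/2≤∣alternating∣ n _)

-- Tight cycles in the parity graph

module _ {k s′ n : ℕ} (A : Subset n) (k<s : k < suc s′) {φ : Fin (suc s′) → Fin n}
         (copy : IsTightCycleCopy (suc s′) (parityGraph k A) φ) where

  private
    s = suc s′

  label : ℕ → Bool
  label m = lookup A (φ (m mod s))

  label-periodic : Periodic label s
  label-periodic m = cong (lookup A ∘ φ) (fromℕ<-cong _ _ ([m+n]%n≡m%n m s) _ _)

  label-toℕ : ∀ i → label (toℕ i) ≡ lookup A (φ i)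
  label-toℕ i = cong (lookup A ∘ φ)
    (trans (fromℕ<-cong _ _ (m<n⇒m%n≡m (toℕ<n i)) _ (toℕ<n i)) (fromℕ<-toℕ i (toℕ<n i)))

  ∣window∩A∣≡count : ∀ i → ∣ window k φ i ∩ A ∣ ≡ count (label ∘ (toℕ i +_)) k
  ∣window∩A∣≡count i =
    trans (cong (λ e → ∣ ⋃ e ∩ A ∣) (map-applyUpTo id (⁅_⁆ ∘ ψ) k)) (∣⋃⁅ψ⁆∩q∣≡count A ψ k ψ-injective)
    where
    ψ : ℕ → Fin n
    ψ j = φ ((toℕ i + j) mod s)
    residues : ∀ {b c} → ψ b ≡ ψ c → (toℕ i + b) % s ≡ (toℕ i + c) % s
    residues ψb≡ψc = trans (sym (toℕ-fromℕ< _)) (trans (cong toℕ (proj₁ copy ψb≡ψc)) (toℕ-fromℕ< _))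
    ψ-injective : ∀ {b c} → b < k → c < k → ψ b ≡ ψ c → b ≡ c
    ψ-injective {b} {c} b<k c<k ψb≡ψc with ≤-total b c
    ... | inj₁ b≤c = [m+i]%n≡[m+j]%n⇒i≡j (toℕ i) b≤c (<-trans c<k k<s) (residues ψb≡ψc)
    ... | inj₂ c≤b = sym ([m+i]%n≡[m+j]%n⇒i≡j (toℕ i) c≤b (<-trans b<k k<s) (sym (residues ψb≡ψc)))

  label-oddWindows : OddWindows label k
  label-oddWindows m = trans (cong parity (count-cong k shift)) (window-odd (m mod s))
    where
    shift : ∀ j → label (m + j) ≡ label (toℕ (m mod s) + j)
    shift j = cong (lookup A ∘ φ) (fromℕ<-cong _ _
      (trans ([m+n]%o≡[m%o+n]%o m j s) (cong (λ r → (r + j) % s) (sym (toℕ-fromℕ< (m%n<n m s))))) _ _)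
    window-odd : ∀ i → parity (count (label ∘ (toℕ i +_)) k) ≡ 1ℙ
    window-odd i = trans (cong parity (sym (∣window∩A∣≡count i)))
                         (isOdd≡true⇒≡1ℙ (∧-conicalʳ _ _ (proj₂ copy i)))

  tightCycle⊆A : Admissible k s → ∀ i → lookup A (φ i) ≡ true
  tightCycle⊆A adm i = trans (sym (label-toℕ i))
    (oddWindows-admissible⇒true adm label-periodic label-oddWindows (toℕ i))

  tightCycle-even-inadmissible : 2 ∣ k → ¬ Admissible k s
  tightCycle-even-inadmissible 2∣k adm with admissible-even 2∣k adm
  ... | q , k≡q*d , 2∣q = oddWindows-quotient-odd label-oddWindows label-periodic {q} k≡q*d 2∣q

parityGraph-noTightCycle : ∀ {k s n} (A : Subset n) → k < s → 2 ∣ k → Admissible k s →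
                           ¬ ContainsTightCycle s (parityGraph k A)
parityGraph-noTightCycle {s = suc s′} A k<s 2∣k adm (φ , copy) =
  tightCycle-even-inadmissible A k<s copy 2∣k adm

alternating-noCovering : ∀ {k s} n → k < s → Admissible k s →
                         ¬ HasTightCycleCovering s (parityGraph k (alternating (suc n) false))
alternating-noCovering {s = suc s′} n k<s adm cover with cover zero
... | φ , copy , i , φi≡0 with trans (cong (lookup (alternating (suc n) false)) (sym φi≡0))
                                     (tightCycle⊆A (alternating (suc n) false) k<s copy adm i)
...   | ()

proposition1p4 : ∀ (k s : ℕ) → 3 ≤ k → k < s → Admissible k s →
    (∀ (n : ℕ) → 1 ≤ n → ∃[ H ] (¬ HasTightCycleCovering {k} {n} s H × MinCodegAtLeast H ((n / 2 + 1) ∸ k)))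
    × (2 ∣ k → ∀ (n : ℕ) → ∃[ H ] (¬ ContainsTightCycle {k} {n} s H × MinCodegAtLeast H ((n / 2 + 1) ∸ k)))
proposition1p4 k s 3≤k k<s adm =
    (λ { (suc n) _ → parityGraph k (alternating (suc n) false)
                   , alternating-noCovering n k<s adm
                   , alternating-minCodeg (suc n) 1≤k })
  , (λ 2∣k n → parityGraph k (alternating n false)
             , parityGraph-noTightCycle (alternating n false) k<s 2∣k adm
             , alternating-minCodeg n 1≤k)
  where
  1≤k : 1 ≤ k
  1≤k = ≤-trans (s≤s z≤n) 3≤k
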